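{- Let $r\ge 4$ and $s\ge 1$ be integers, and let $G=C_r[K_s]$. Let $H$ be a connected induced subgraph of $G$ that is regular of degree $d$. Then one of the following holds: (i) $H$ is a clique of order $d+1$, where $0\le d\le 2s-1$; or (ii) $r(d+1)/3$ is an integer, $2\le d\le 3s-1$, $H$ has order $r(d+1)/3$, and every vertex of $G$ is adjacent to some vertex of $H$.
   Context: $C_r$ is the cycle on $r$ vertices and $K_s$ the complete graph on $s$ vertices. The lexicographic product $C_r[K_s]$ is the graph obtained from $C_r$ by replacing each vertex $i$ by a clique $B_i$ of order $s$, and joining every vertex of $B_i$ to every vertex of $B_j$ whenever $i$ and $j$ are adjacent in $C_r$ (and no other edges between different cliques). -}

module Defs where

open import Data.Nat using (ℕ; zero; suc)
open import Data.Fin using (Fin; toℕ)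
open import Data.Bool using (Bool; true)
open import Data.Product using (Σ; _×_; _,_)
open import Data.Sum using (_⊎_)
open import Data.List using (List; length)
open import Data.List.Membership.Propositional using (_∈_)
open import Data.List.Relation.Unary.Unique.Propositional using (Unique)
open import Relation.Binary.PropositionalEquality using (_≡_; _≢_)
open import Relation.Nullary using (¬_)
open import Function.Bundles using (_⇔_)

CycNext : {r : ℕ} → Fin r → Fin r → Set
CycNext {r} i j = (toℕ j ≡ suc (toℕ i)) ⊎ (suc (toℕ i) ≡ r × toℕ j ≡ 0)

CycAdj : {r : ℕ} → Fin r → Fin r → Set
CycAdj i j = CycNext i j ⊎ CycNext j i

-- Vertices of the lexicographic product C_r[K_s]: (i , a) is vertex a of clique B_i.
V : ℕ → ℕ → Set
V r s = Fin r × Fin s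

Adj : {r s : ℕ} → V r s → V r s → Set
Adj (i , a) (j , b) = (i ≡ j × a ≢ b) ⊎ CycAdj i j

-- An induced subgraph H of G is given by its vertex set S (decidable subset).
VSet : ℕ → ℕ → Set
VSet r s = V r s → Bool

_∈S_ : {r s : ℕ} → V r s → VSet r s → Set
v ∈S S = S v ≡ true

HasSize : {r s : ℕ} → (V r s → Set) → ℕ → Set
HasSize {r} {s} P n =
  Σ (List (V r s)) λ L → Unique L × (∀ u → (u ∈ L) ⇔ P u) × length L ≡ n

data Walk {r s : ℕ} (S : VSet r s) : V r s → V r s → Set where
  here : ∀ {v} → v ∈S S → Walk S v v
  step : ∀ {u v w} → u ∈S S → Adj u v → Walk S v w → Walk S u w

Connected : {r s : ℕ} → VSet r s → Set
Connected {r} {s} S =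
  Σ (V r s) (λ v → v ∈S S) ×
  (∀ u v → u ∈S S → v ∈S S → Walk S u v)

Regular : {r s : ℕ} → VSet r s → ℕ → Set
Regular S d = ∀ v → v ∈S S → HasSize (λ u → u ∈S S × Adj v u) d

IsClique : {r s : ℕ} → VSet r s → Set
IsClique S = ∀ u v → u ∈S S → v ∈S S → u ≢ v → Adj u v

Order : {r s : ℕ} → VSet r s → ℕ → Set
Order S n = HasSize (λ u → u ∈S S) n

Dominating : {r s : ℕ} → VSet r s → Set
Dominating {r} {s} S = ∀ (v : V r s) → Σ (V r s) λ u → u ∈S S × Adj v u

{-# OPTIONS --safe #-}
module Submission where

-- Let x i be the number of vertices of H in the clique B i.  The closed neighbourhood in H of a
-- vertex of B i is H ∩ (B (i-1) ∪ B i ∪ B (i+1)), three distinct cliques as r ≥ 3, so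
-- d + 1 = x (i-1) + x i + x (i+1) whenever x i > 0.  If some x k = 0, take j with
-- x (j-1) = 0 < x j; then d + 1 = x j + x (j+1), and if x (j+1) > 0 the equation at j+1 forces
-- x (j+2) = 0.  No edge leaves B j ∪ B (j+1) inside H, so by connectedness H is contained in
-- this clique.  Otherwise every B i meets H, so H dominates G, and summing the equation over
-- the cycle counts every vertex of H three times: 3 |H| = r (d + 1).

open import Defs
open import Data.Nat using (ℕ; zero; suc; _+_; _*_; _≤_; _<_; z≤n; s≤s; s≤s⁻¹)
open import Data.Nat.Properties
  using (<-irrefl; ≤-trans; ≤-reflexive; +-mono-≤; +-cancelˡ-≡; +-identityʳ; *-zeroʳ;
         0≢1+n; 1+n≢n; m≢1+n+m; n≢0⇒n>0; suc-injective; <⇒≤; +-commutativeSemigroup)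
  renaming (_≟_ to _≟ℕ_)
open import Algebra.Properties.CommutativeSemigroup +-commutativeSemigroup
  using () renaming (interchange to +-interchange)
open import Data.Nat.ListAction using (sum)
open import Data.Nat.ListAction.Properties using (sum-↭)
open import Data.Fin using (Fin; zero; suc; toℕ; fromℕ; inject₁)
open import Data.Fin.Properties using (toℕ-injective; toℕ<n; toℕ-fromℕ; toℕ-inject₁; ≤fromℕ; any?)
  renaming (_≟_ to _≟F_)
open import Data.Fin.Induction using (<-weakInduction; <-weakInduction-startingFrom)
open import Data.Fin.Relation.Unary.Top using (view; ‵fromℕ; ‵inj₁)
open import Data.Bool using (true)
open import Data.Bool.Properties using () renaming (_≟_ to _≟B_)
open import Data.Product using (Σ; ∃; _×_; _,_; proj₁; proj₂)
open import Data.Sum using (_⊎_; inj₁; inj₂; [_,_])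
import Data.Sum as Sum
open import Data.Empty using (⊥-elim)
open import Data.List using (List; []; _∷_; _++_; length; map; filter; allFin)
open import Data.List.Properties using (length-++; length-map; length-tabulate; length-filter; map-cong; map-∘)
open import Data.List.Membership.Propositional using (_∈_)
open import Data.List.Membership.Propositional.Properties
  using (∈-++⁺ˡ; ∈-++⁺ʳ; ∈-++⁻; ∈-filter⁺; ∈-filter⁻; ∈-map⁺; ∈-map⁻; ∈-allFin)
open import Data.List.Membership.Propositional.Properties.WithK using (unique∧set⇒bag)
open import Data.List.Relation.Binary.BagAndSetEquality using (∼bag⇒↭)
open import Data.List.Relation.Binary.Permutation.Propositional using (_↭_)
import Data.List.Relation.Binary.Permutation.Propositional.Properties as ↭
import Data.List.Relation.Unary.All as All
open import Data.List.Relation.Unary.Any using (here; there)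
open import Data.List.Relation.Unary.AllPairs using ([]; _∷_)
open import Data.List.Relation.Unary.Unique.Propositional using (Unique)
import Data.List.Relation.Unary.Unique.Propositional.Properties as Unique
open import Function using (_∘_; id)
open import Function.Bundles using (_⇔_; mk⇔; Equivalence)
import Function.Properties.Equivalence as ⇔
open import Relation.Binary.PropositionalEquality
  using (_≡_; _≢_; refl; sym; trans; cong; cong₂; subst; module ≡-Reasoning)
open import Relation.Nullary using (¬_; yes; no)
open import Relation.Nullary.Decidable using (¬?; _×-dec_; decidable-stable)
open import Relation.Unary using (Decidable)

open Equivalence using (to; from)

module _ {r s : ℕ} {P Q : V r s → Set} where

  HasSize-resp : (∀ u → P u ⇔ Q u) → ∀ {n} → HasSize P n → HasSize Q n
  HasSize-resp P⇔Q (L , uniq , L⇔P , len) = L , uniq , (λ u → ⇔.trans (L⇔P u) (P⇔Q u)) , len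

  HasSize-⊎ : ∀ {m n} → HasSize P m → HasSize Q n → (∀ {u} → P u → ¬ Q u) →
              HasSize (λ u → P u ⊎ Q u) (m + n)
  HasSize-⊎ (L , uL , L⇔P , refl) (L′ , uL′ , L′⇔Q , refl) disjoint =
    L ++ L′ ,
    Unique.++⁺ uL uL′ (λ (u∈L , u∈L′) → disjoint (to (L⇔P _) u∈L) (to (L′⇔Q _) u∈L′)) ,
    (λ u → mk⇔ (Sum.map (to (L⇔P u)) (to (L′⇔Q u)) ∘ ∈-++⁻ L)
               [ ∈-++⁺ˡ ∘ from (L⇔P u) , ∈-++⁺ʳ L ∘ from (L′⇔Q u) ]) ,
    length-++ L

module _ {r s : ℕ} {P : V r s → Set} where

  HasSize-empty : (∀ u → ¬ P u) → HasSize P 0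
  HasSize-empty ¬P = [] , [] , (λ u → mk⇔ (λ ()) (⊥-elim ∘ ¬P u)) , refl

  HasSize-filter : (P? : Decidable P) (L : List (V r s)) → Unique L →
                   HasSize (λ u → u ∈ L × P u) (length (filter P? L))
  HasSize-filter P? L uniq =
    filter P? L , Unique.filter⁺ P? uniq ,
    (λ u → mk⇔ (∈-filter⁻ P?) (λ (u∈L , Pu) → ∈-filter⁺ P? u∈L Pu)) , refl

  HasSize-unique : ∀ {m n} → HasSize P m → HasSize P n → m ≡ n
  HasSize-unique (L , uL , L⇔P , refl) (L′ , uL′ , L′⇔P , refl) =
    ↭.↭-length (∼bag⇒↭ (unique∧set⇒bag uL uL′ (λ {u} → ⇔.trans (L⇔P u) (⇔.sym (L′⇔P u)))))

  HasSize-witness : ∀ {n} → HasSize P n → 0 < n → ∃ P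
  HasSize-witness ([] , _ , _ , refl) ()
  HasSize-witness (u ∷ _ , _ , L⇔P , _) _ = u , to (L⇔P u) (here refl)

  HasSize-pos : ∀ {n u} → HasSize P n → P u → 0 < n
  HasSize-pos (_ ∷ _ , _ , _ , refl) _ = s≤s z≤n
  HasSize-pos ([] , _ , L⇔P , refl) Pu with () ← from (L⇔P _) Pu

HasSize-singleton : ∀ {r s} (v : V r s) → HasSize (_≡ v) 1
HasSize-singleton v = v ∷ [] , All.[] ∷ [] , (λ u → mk⇔ (λ { (here u≡v) → u≡v }) here) , refl

Walk-start : ∀ {r s} {S : VSet r s} {u w} → Walk S u w → u ∈S S
Walk-start (here u∈S) = u∈S
Walk-start (step u∈S _ _) = u∈S

Walk-preserves : ∀ {r s} {S : VSet r s} (Q : V r s → Set) →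
                 (∀ {u w} → u ∈S S → w ∈S S → Adj u w → Q u → Q w) →
                 ∀ {u w} → Walk S u w → Q u → Q w
Walk-preserves Q closed (here _) Qu = Qu
Walk-preserves Q closed (step u∈S adj walk) Qu =
  Walk-preserves Q closed walk (closed u∈S (Walk-start walk) adj Qu)

module _ {A : Set} where

  sum-map-const : ∀ c (xs : List A) → sum (map (λ _ → c) xs) ≡ length xs * c
  sum-map-const c [] = refl
  sum-map-const c (_ ∷ xs) = cong (c +_) (sum-map-const c xs)

  sum-map-+ : ∀ (f g : A → ℕ) xs → sum (map (λ a → f a + g a) xs) ≡ sum (map f xs) + sum (map g xs)
  sum-map-+ f g [] = refl
  sum-map-+ f g (a ∷ xs) = begin
    f a + g a + sum (map (λ a → f a + g a) xs)           ≡⟨ cong (f a + g a +_) (sum-map-+ f g xs) ⟩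
    f a + g a + (sum (map f xs) + sum (map g xs))         ≡⟨ +-interchange (f a) (g a) _ _ ⟩
    f a + sum (map f xs) + (g a + sum (map g xs))         ∎
    where open ≡-Reasoning

  sum-map-swap : ∀ (fs : List (A → ℕ)) xs →
                 sum (map (λ a → sum (map (λ f → f a) fs)) xs) ≡ sum (map (λ f → sum (map f xs)) fs)
  sum-map-swap [] xs = trans (sum-map-const 0 xs) (*-zeroʳ (length xs))
  sum-map-swap (f ∷ fs) xs =
    trans (sum-map-+ f (λ a → sum (map (λ g → g a) fs)) xs) (cong (sum (map f xs) +_) (sum-map-swap fs xs))

allFin-↭ : ∀ {n} {f g : Fin n → Fin n} → (∀ i → g (f i) ≡ i) → (∀ j → f (g j) ≡ j) →
           map f (allFin n) ↭ allFin n
allFin-↭ {n} {f} {g} g∘f f∘g = ∼bag⇒↭ (unique∧set⇒bag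
  (Unique.map⁺ (λ {i} {j} e → trans (sym (g∘f i)) (trans (cong g e) (g∘f j))) (Unique.allFin⁺ n))
  (Unique.allFin⁺ n)
  (λ {j} → mk⇔ (λ _ → ∈-allFin j)
                (λ _ → subst (_∈ map f (allFin n)) (f∘g j) (∈-map⁺ f (∈-allFin (g j))))))

sum-map-bijection : ∀ {n} (h : Fin n → ℕ) {f g : Fin n → Fin n} →
                    (∀ i → g (f i) ≡ i) → (∀ j → f (g j) ≡ j) →
                    sum (map (h ∘ f) (allFin n)) ≡ sum (map h (allFin n))
sum-map-bijection {n} h {f} g∘f f∘g =
  trans (cong sum (map-∘ (allFin n))) (sum-↭ (↭.map⁺ h (allFin-↭ g∘f f∘g)))

module _ {r : ℕ} {i j k : Fin r} where

  CycNext-functional : CycNext i j → CycNext i k → j ≡ k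
  CycNext-functional (inj₁ j≡1+i) (inj₁ k≡1+i) = toℕ-injective (trans j≡1+i (sym k≡1+i))
  CycNext-functional (inj₂ (_ , j≡0)) (inj₂ (_ , k≡0)) = toℕ-injective (trans j≡0 (sym k≡0))
  CycNext-functional (inj₁ j≡1+i) (inj₂ (1+i≡r , _)) = ⊥-elim (<-irrefl (trans j≡1+i 1+i≡r) (toℕ<n j))
  CycNext-functional (inj₂ (1+i≡r , _)) (inj₁ k≡1+i) = ⊥-elim (<-irrefl (trans k≡1+i 1+i≡r) (toℕ<n k))

  CycNext-injective : CycNext i k → CycNext j k → i ≡ j
  CycNext-injective (inj₁ k≡1+i) (inj₁ k≡1+j) = toℕ-injective (suc-injective (trans (sym k≡1+i) k≡1+j))
  CycNext-injective (inj₂ (1+i≡r , _)) (inj₂ (1+j≡r , _)) =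
    toℕ-injective (suc-injective (trans 1+i≡r (sym 1+j≡r)))
  CycNext-injective (inj₁ k≡1+i) (inj₂ (_ , k≡0)) = ⊥-elim (0≢1+n (trans (sym k≡0) k≡1+i))
  CycNext-injective (inj₂ (_ , k≡0)) (inj₁ k≡1+j) = ⊥-elim (0≢1+n (trans (sym k≡0) k≡1+j))

module _ {m : ℕ} where

  prev : Fin (suc m) → Fin (suc m)
  prev zero = fromℕ m
  prev (suc i) = inject₁ i

  next : Fin (suc m) → Fin (suc m)
  next i with view i
  ... | ‵fromℕ = zero
  ... | ‵inj₁ {i = i} _ = suc i

  CycNext-prev : ∀ j → CycNext (prev j) j
  CycNext-prev zero = inj₂ (cong suc (toℕ-fromℕ m) , refl)
  CycNext-prev (suc i) = inj₁ (cong suc (sym (toℕ-inject₁ i)))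

  CycNext-next : ∀ i → CycNext i (next i)
  CycNext-next i with view i
  ... | ‵fromℕ = inj₂ (cong suc (toℕ-fromℕ m) , refl)
  ... | ‵inj₁ {i = i} _ = inj₁ (cong suc (sym (toℕ-inject₁ i)))

  CycNext⇒≡next : ∀ {i j} → CycNext i j → j ≡ next i
  CycNext⇒≡next {i} c = CycNext-functional c (CycNext-next i)

  CycNext⇒≡prev : ∀ {i j} → CycNext i j → i ≡ prev j
  CycNext⇒≡prev {j = j} c = CycNext-injective c (CycNext-prev j)

  prev-next : ∀ i → prev (next i) ≡ i
  prev-next i = sym (CycNext⇒≡prev (CycNext-next i))

  next-prev : ∀ j → next (prev j) ≡ j
  next-prev j = sym (CycNext⇒≡next (CycNext-prev j))

  CycNext-irrefl : 1 ≤ m → ∀ {i} → ¬ CycNext i i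
  CycNext-irrefl _ (inj₁ i≡1+i) = 1+n≢n (sym i≡1+i)
  CycNext-irrefl 1≤m (inj₂ (1+i≡1+m , i≡0)) = <-irrefl (sym (trans (sym (suc-injective 1+i≡1+m)) i≡0)) 1≤m

  CycNext-asym : 2 ≤ m → ∀ {i j} → CycNext i j → ¬ CycNext j i
  CycNext-asym _ {i} (inj₁ j≡1+i) (inj₁ i≡1+j) = m≢1+n+m (toℕ i) {n = 1} (trans i≡1+j (cong suc j≡1+i))
  CycNext-asym 2≤m (inj₁ j≡1+i) (inj₂ (1+j≡1+m , i≡0)) =
    <-irrefl (sym (trans (sym (suc-injective 1+j≡1+m)) (trans j≡1+i (cong suc i≡0)))) 2≤m
  CycNext-asym 2≤m (inj₂ (1+i≡1+m , j≡0)) (inj₁ i≡1+j) =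
    <-irrefl (sym (trans (sym (suc-injective 1+i≡1+m)) (trans i≡1+j (cong suc j≡0)))) 2≤m
  CycNext-asym 2≤m (inj₂ (1+i≡1+m , _)) (inj₂ (_ , i≡0)) =
    <-irrefl (sym (trans (sym (suc-injective 1+i≡1+m)) i≡0)) (≤-trans (s≤s z≤n) 2≤m)

  closedBlocks : Fin (suc m) → List (Fin (suc m))
  closedBlocks i = prev i ∷ i ∷ next i ∷ []

  prev≢self : 1 ≤ m → ∀ {i} → prev i ≢ i
  prev≢self 1≤m {i} e = CycNext-irrefl 1≤m (subst (λ k → CycNext k i) e (CycNext-prev i))

  self≢next : 1 ≤ m → ∀ {i} → i ≢ next i
  self≢next 1≤m {i} e = CycNext-irrefl 1≤m (subst (CycNext i) (sym e) (CycNext-next i))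

  prev≢next : 2 ≤ m → ∀ {i} → prev i ≢ next i
  prev≢next 2≤m {i} e = CycNext-asym 2≤m (CycNext-next i) (subst (λ k → CycNext k i) e (CycNext-prev i))

  closedBlocks-unique : 2 ≤ m → ∀ i → Unique (closedBlocks i)
  closedBlocks-unique 2≤m i =
    (prev≢self 1≤m All.∷ prev≢next 2≤m All.∷ All.[]) ∷ (self≢next 1≤m All.∷ All.[]) ∷ All.[] ∷ []
    where 1≤m = <⇒≤ 2≤m

  boundary : {Z : Fin (suc m) → Set} → Decidable Z → ∀ {k i} → Z k → ¬ Z i → ∃ λ j → ¬ Z j × Z (prev j)
  boundary {Z} Z? {k} {i} Zk ¬Zi with any? (λ j → ¬? (Z? j) ×-dec Z? (prev j))
  ... | yes found = found
  -- Otherwise Z spreads from k up to the last element, wraps round to zero and reaches i.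
  ... | no none = ⊥-elim (¬Zi (<-weakInduction Z Z-zero (closed ∘ suc) i))
    where
    closed : ∀ j → Z (prev j) → Z j
    closed j Zprev = decidable-stable (Z? j) (λ ¬Zj → none (j , ¬Zj , Zprev))
    Z-zero : Z zero
    Z-zero = closed zero (<-weakInduction-startingFrom Z Zk (closed ∘ suc) (≤fromℕ k))

module _ {m s : ℕ} where

  Adj-irrefl : 1 ≤ m → {u : V (suc m) s} → ¬ Adj u u
  Adj-irrefl _ (inj₁ (_ , a≢a)) = a≢a refl
  Adj-irrefl 1≤m (inj₂ (inj₁ c)) = CycNext-irrefl 1≤m c
  Adj-irrefl 1≤m (inj₂ (inj₂ c)) = CycNext-irrefl 1≤m c

  Adj⇒∈closedBlocks : ∀ {i j : Fin (suc m)} {a b : Fin s} → Adj (i , a) (j , b) → j ∈ closedBlocks i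
  Adj⇒∈closedBlocks (inj₁ (refl , _)) = there (here refl)
  Adj⇒∈closedBlocks (inj₂ (inj₁ c)) = there (there (here (CycNext⇒≡next c)))
  Adj⇒∈closedBlocks (inj₂ (inj₂ c)) = here (CycNext⇒≡prev c)

  ∈closedBlocks⇒≡⊎Adj : ∀ {i j : Fin (suc m)} {a b : Fin s} → j ∈ closedBlocks i →
                        (j , b) ≡ (i , a) ⊎ Adj (i , a) (j , b)
  ∈closedBlocks⇒≡⊎Adj {i} (here refl) = inj₂ (inj₂ (inj₂ (CycNext-prev i)))
  ∈closedBlocks⇒≡⊎Adj {a = a} {b} (there (here refl)) with b ≟F a
  ... | yes refl = inj₁ refl
  ... | no b≢a = inj₂ (inj₁ (refl , b≢a ∘ sym))
  ∈closedBlocks⇒≡⊎Adj {i} (there (there (here refl))) = inj₂ (inj₂ (inj₁ (CycNext-next i)))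

  consecutive-Adj : ∀ t {u w : V (suc m) s} → proj₁ u ∈ t ∷ next t ∷ [] → proj₁ w ∈ t ∷ next t ∷ [] →
                    u ≢ w → Adj u w
  consecutive-Adj t (here refl) (here refl) u≢w = inj₁ (refl , u≢w ∘ cong (t ,_))
  consecutive-Adj t (here refl) (there (here refl)) _ = inj₂ (inj₁ (CycNext-next t))
  consecutive-Adj t (there (here refl)) (here refl) _ = inj₂ (inj₂ (CycNext-next t))
  consecutive-Adj t (there (here refl)) (there (here refl)) u≢w = inj₁ (refl , u≢w ∘ cong (next t ,_))

module Blocks {r s : ℕ} (S : VSet r s) where

  _∈S? : Decidable (_∈S S)
  u ∈S? = S u ≟B true

  block : Fin r → List (V r s)
  block i = map (i ,_) (allFin s)

  ∈block⇔ : ∀ {i} u → u ∈ block i ⇔ proj₁ u ≡ i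
  ∈block⇔ {i} u = mk⇔ (λ u∈B → let (_ , _ , u≡ia) = ∈-map⁻ (i ,_) u∈B in cong proj₁ u≡ia)
                      (λ { refl → ∈-map⁺ (i ,_) (∈-allFin (proj₂ u)) })

  blockSize : Fin r → ℕ
  blockSize i = length (filter _∈S? (block i))

  blockSize-HasSize : ∀ i → HasSize (λ u → u ∈S S × proj₁ u ≡ i) (blockSize i)
  blockSize-HasSize i =
    HasSize-resp (λ u → mk⇔ (λ (u∈B , u∈S) → u∈S , to (∈block⇔ u) u∈B)
                            (λ (u∈S , u∈Bᵢ) → from (∈block⇔ u) u∈Bᵢ , u∈S))
                 (HasSize-filter _∈S? (block i) (Unique.map⁺ (cong proj₂) (Unique.allFin⁺ s)))

  blockSize≤ : ∀ i → blockSize i ≤ s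
  blockSize≤ i = ≤-trans (length-filter _∈S? (block i))
                         (≤-reflexive (trans (length-map (i ,_) (allFin s)) (length-tabulate {n = s} id)))

  occupied⇒blockSize>0 : ∀ {i a} → (i , a) ∈S S → 0 < blockSize i
  occupied⇒blockSize>0 ia∈S = HasSize-pos (blockSize-HasSize _) (ia∈S , refl)

  blockSize>0⇒occupied : ∀ {i} → 0 < blockSize i → ∃ λ a → (i , a) ∈S S
  blockSize>0⇒occupied {i} pos with HasSize-witness (blockSize-HasSize i) pos
  ... | (_ , a) , ia∈S , refl = a , ia∈S

  HasSize-blocks : (is : List (Fin r)) → Unique is →
                   HasSize (λ u → u ∈S S × proj₁ u ∈ is) (sum (map blockSize is))
  HasSize-blocks [] _ = HasSize-empty (λ { _ (_ , ()) })
  HasSize-blocks (i ∷ is) (i∉is ∷ uniq) =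
    HasSize-resp (λ u → mk⇔ [ (λ (u∈S , u∈Bᵢ) → u∈S , here u∈Bᵢ) , (λ (u∈S , ∈is) → u∈S , there ∈is) ]
                            (λ { (u∈S , here u∈Bᵢ) → inj₁ (u∈S , u∈Bᵢ)
                               ; (u∈S , there ∈is) → inj₂ (u∈S , ∈is) }))
                 (HasSize-⊎ (blockSize-HasSize i) (HasSize-blocks is uniq)
                            (λ (_ , u∈Bᵢ) (_ , ∈is) → All.lookup i∉is ∈is (sym u∈Bᵢ)))

  Order-blocks : (is : List (Fin r)) → Unique is → (∀ {u} → u ∈S S → proj₁ u ∈ is) →
                 Order S (sum (map blockSize is))
  Order-blocks is uniq covers =
    HasSize-resp (λ u → mk⇔ proj₁ (λ u∈S → u∈S , covers u∈S)) (HasSize-blocks is uniq)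

module RegularInducedSubgraph {m s d : ℕ} (2≤m : 2 ≤ m) (S : VSet (suc m) s) (reg : Regular S d) where

  open Blocks S

  1≤m : 1 ≤ m
  1≤m = <⇒≤ 2≤m

  empty⇒unoccupied : ∀ {t b} → blockSize t ≡ 0 → ¬ (t , b) ∈S S
  empty⇒unoccupied t-empty tb∈S = <-irrefl (sym t-empty) (occupied⇒blockSize>0 tb∈S)

  closedNeighbourhood⇔ : ∀ {i a} → (i , a) ∈S S → ∀ u →
    (u ≡ (i , a) ⊎ (u ∈S S × Adj (i , a) u)) ⇔ (u ∈S S × proj₁ u ∈ closedBlocks i)
  closedNeighbourhood⇔ v∈S (j , b) = mk⇔
    [ (λ { refl → v∈S , there (here refl) }) , (λ (u∈S , adj) → u∈S , Adj⇒∈closedBlocks adj) ]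
    (λ (u∈S , j∈N) → Sum.map₂ (u∈S ,_) (∈closedBlocks⇒≡⊎Adj j∈N))

  closedBlocks-sum : ∀ {i} → 0 < blockSize i → suc d ≡ sum (map blockSize (closedBlocks i))
  closedBlocks-sum {i} i-occupied with blockSize>0⇒occupied i-occupied
  ... | a , v∈S = HasSize-unique
    (HasSize-resp (closedNeighbourhood⇔ v∈S)
      (HasSize-⊎ (HasSize-singleton (i , a)) (reg (i , a) v∈S) (λ { refl (_ , adj) → Adj-irrefl 1≤m adj })))
    (HasSize-blocks (closedBlocks i) (closedBlocks-unique 2≤m i))

  module BoundaryBlock (conn : Connected S) {j} (j-occupied : 0 < blockSize j) (prev-empty : blockSize (prev j) ≡ 0) where

    gap : List (Fin (suc m))
    gap = j ∷ next j ∷ []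

    gap-sum : suc d ≡ sum (map blockSize gap)
    gap-sum = trans (closedBlocks-sum j-occupied) (cong (_+ sum (map blockSize gap)) prev-empty)

    after-next-empty : 0 < blockSize (next j) → blockSize (next (next j)) ≡ 0
    after-next-empty next-occupied =
      trans (sym (+-identityʳ _))
            (+-cancelˡ-≡ (blockSize (next j)) _ _ (+-cancelˡ-≡ (blockSize j) _ _ (trans (sym next-sum) gap-sum)))
      where
      next-sum : suc d ≡ blockSize j + (blockSize (next j) + (blockSize (next (next j)) + 0))
      next-sum = trans (closedBlocks-sum next-occupied)
                       (cong (λ t → blockSize t + sum (map blockSize (next j ∷ next (next j) ∷ []))) (prev-next j))

    stays-in-gap : ∀ {u w} → u ∈S S → w ∈S S → Adj u w → proj₁ u ∈ gap → proj₁ w ∈ gap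
    stays-in-gap {_ , _} {_ , _} u∈S w∈S adj i∈gap with Adj⇒∈closedBlocks adj | i∈gap
    ... | here refl | here refl = ⊥-elim (empty⇒unoccupied prev-empty w∈S)
    ... | here refl | there (here refl) = here (prev-next j)
    ... | there (here refl) | _ = i∈gap
    ... | there (there (here refl)) | here refl = there (here refl)
    ... | there (there (here refl)) | there (here refl) =
      ⊥-elim (empty⇒unoccupied (after-next-empty (occupied⇒blockSize>0 u∈S)) w∈S)

    support : ∀ {u} → u ∈S S → proj₁ u ∈ gap
    support u∈S with blockSize>0⇒occupied j-occupied
    ... | a , ja∈S = Walk-preserves (λ u → proj₁ u ∈ gap) stays-in-gap (proj₂ conn _ _ ja∈S u∈S) (here refl)

    clique : IsClique S
    clique u w u∈S w∈S = consecutive-Adj j (support u∈S) (support w∈S)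

    order : Order S (suc d)
    order = subst (Order S) (sym gap-sum)
                  (Order-blocks gap ((self≢next 1≤m All.∷ All.[]) ∷ All.[] ∷ []) support)

    bound : suc d ≤ 2 * s
    bound = subst (_≤ 2 * s) (sym gap-sum) (+-mono-≤ (blockSize≤ j) (+-mono-≤ (blockSize≤ (next j)) z≤n))

  module AllBlocksOccupied (occupied : ∀ t → 0 < blockSize t) where

    all : List (Fin (suc m))
    all = allFin (suc m)

    n : ℕ
    n = sum (map blockSize all)

    order : Order S n
    order = Order-blocks all (Unique.allFin⁺ _) (λ _ → ∈-allFin _)

    3n≡r[d+1] : 3 * n ≡ suc m * suc d
    3n≡r[d+1] = begin
      n + (n + (n + 0))
        ≡⟨ cong₂ (λ p q → p + (n + (q + 0))) (sum-map-bijection blockSize {prev} {next} next-prev prev-next)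
                                            (sum-map-bijection blockSize {next} {prev} prev-next next-prev) ⟨
      sum (map (blockSize ∘ prev) all) + (n + (sum (map (blockSize ∘ next) all) + 0))
        ≡⟨ sum-map-swap (blockSize ∘ prev ∷ blockSize ∷ blockSize ∘ next ∷ []) all ⟨
      sum (map (λ t → sum (map blockSize (closedBlocks t))) all)
        ≡⟨ cong sum (map-cong (λ t → closedBlocks-sum (occupied t)) all) ⟨
      sum (map (λ _ → suc d) all)
        ≡⟨ sum-map-const (suc d) all ⟩
      length all * suc d
        ≡⟨ cong (_* suc d) (length-tabulate {n = suc m} id) ⟩
      suc m * suc d ∎
      where open ≡-Reasoning

    2≤d : 2 ≤ d
    2≤d = s≤s⁻¹ (subst (3 ≤_) (sym (closedBlocks-sum (occupied zero)))
                       (+-mono-≤ (occupied _) (+-mono-≤ (occupied _) (+-mono-≤ (occupied _) z≤n))))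

    bound : suc d ≤ 3 * s
    bound = subst (_≤ 3 * s) (sym (closedBlocks-sum (occupied zero)))
                  (+-mono-≤ (blockSize≤ _) (+-mono-≤ (blockSize≤ _) (+-mono-≤ (blockSize≤ _) z≤n)))

    dominating : Dominating S
    dominating (i , _) with blockSize>0⇒occupied (occupied (next i))
    ... | b , b∈S = (next i , b) , b∈S , inj₂ (inj₁ (CycNext-next i))

  classification : Connected S →
    (IsClique S × Order S (suc d) × suc d ≤ 2 * s)
    ⊎ (Σ ℕ λ n → 3 * n ≡ suc m * suc d × 2 ≤ d × suc d ≤ 3 * s × Order S n × Dominating S)
  classification conn with any? (λ t → blockSize t ≟ℕ 0)
  ... | no noneEmpty = inj₂ (n , 3n≡r[d+1] , 2≤d , bound , order , dominating)
    where open AllBlocksOccupied (λ t → n≢0⇒n>0 (λ t-empty → noneEmpty (t , t-empty)))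
  ... | yes (_ , k-empty) with proj₁ conn
  ... | (_ , v∈S) with boundary (λ t → blockSize t ≟ℕ 0) k-empty (λ e → empty⇒unoccupied e v∈S)
  ... | _ , j-nonempty , prev-empty = inj₁ (clique , order , bound)
    where open BoundaryBlock conn (n≢0⇒n>0 j-nonempty) prev-empty

lemma6 : (r s d : ℕ) → 4 ≤ r → 1 ≤ s → (S : VSet r s) →
    Connected S → Regular S d →
    (IsClique S × Order S (suc d) × suc d ≤ 2 * s)
    ⊎ (Σ ℕ λ n → 3 * n ≡ r * suc d × 2 ≤ d × suc d ≤ 3 * s × Order S n × Dominating S)
lemma6 (suc m) s d (s≤s 3≤m) _ S conn reg = RegularInducedSubgraph.classification (<⇒≤ 3≤m) S reg conn
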